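{- Let $\mathcal{U}$ be a dead-ending universe and let $G$ be any game. Then $G$ is Left $\mathcal{U}$-strong if and only if $o(G+X)\geq\mathscr{N}$ for all $X\in T_n(\mathcal{U})$, where $n$ is the formal birthday of $G$.
   Context: All games are finite partizan games $\{\mathscr{G}^L\mid\mathscr{G}^R\}$; $0=\{\cdot\mid\cdot\}$. Disjunctive sum $G+H=\{G^L+H,G+H^L\mid G^R+H,G+H^R\}$; conjugate $\overline{G}=\{\overline{G^R}\mid\overline{G^L}\}$. Misère outcomes: $o^L(G)=\mathscr{L}$ iff $G$ has no Left option or some $o^R(G^L)=\mathscr{L}$ (else $\mathscr{R}$); $o^R(G)=\mathscr{R}$ iff $G$ has no Right option or some $o^L(G^R)=\mathscr{R}$ (else $\mathscr{L}$); $o(G)=\mathscr{L},\mathscr{N},\mathscr{P},\mathscr{R}$ for $(o^L,o^R)=(\mathscr{L},\mathscr{L}),(\mathscr{L},\mathscr{R}),(\mathscr{R},\mathscr{L}),(\mathscr{R},\mathscr{R})$, ordered $\mathscr{L}>\mathscr{N}>\mathscr{R}$, $\mathscr{L}>\mathscr{P}>\mathscr{R}$. A universe is a set of games closed under options, sums, conjugates, and forming $\{\mathscr{S}\mid\mathscr{T}\}$ for nonempty finite subsets $\mathscr{S},\mathscr{T}$. A Left end has no Left option; a Left dead-end is a game all of whose subpositions are Left ends; a Right end/dead-end is defined symmetrically. A game is dead-ending if each subposition that is a Left end is a Left dead-end and each subposition that is a Right end is a Right dead-end; a universe is dead-ending if all its elements are. $G$ is Left $\mathcal{U}$-strong if $o(G+X)\geq\mathscr{N}$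 for every Left end $X\in\mathcal{U}$. The formal birthday of $G$ is the height of its game tree. The $n$th truncation is $\tau_0(G)=0$, $\tau_{n+1}(G)=\{\tau_n(G^L)\mid\tau_n(G^R)\}$. For Left dead-ends, $G\geq H$ means $o(G+X)\geq o(H+X)$ for all games $X$. $\mathrm{cl}(\mathcal{A})$ is the smallest set containing $\mathcal{A}$ closed under options and sums. For a dead-ending universe $\mathcal{U}$ with set of Left ends $\mathcal{A}$ (all Left dead-ends), $T_n(\mathcal{U})$ is the (finite) set of minimal elements, with respect to $\geq$, of $\{\tau_n(G):G\in\mathrm{cl}(\mathcal{A})\}$. -}

module Defs where

open import Data.Nat using (ℕ; zero; suc; _⊔_)
open import Data.Bool using (Bool; true; false; not; _∨_)
open import Data.List using (List; []; _∷_; _++_; map)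
open import Data.List.Membership.Propositional using (_∈_)
open import Data.List.Relation.Unary.All using (All)
open import Data.Product using (Σ; _×_; ∃)
open import Relation.Binary.PropositionalEquality using (_≡_; _≢_)

data Game : Set where
  mk : List Game → List Game → Game

lefts : Game → List Game
lefts (mk GL _) = GL

rights : Game → List Game
rights (mk _ GR) = GR

zeroG : Game
zeroG = mk [] []

infixl 6 _+_

mutual
  _+_ : Game → Game → Game
  G@(mk GL GR) + H@(mk HL HR) =
    mk (sumL GL H ++ sumR G HL) (sumL GR H ++ sumR G HR)

  sumL : List Game → Game → List Game
  sumL [] H = []
  sumL (g ∷ gs) H = (g + H) ∷ sumL gs H

  sumR : Game → List Game → List Game
  sumR G [] = []
  sumR G (h ∷ hs) = (G + h) ∷ sumR G hs

mutual
  conj : Game → Game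
  conj (mk GL GR) = mk (conjs GR) (conjs GL)

  conjs : List Game → List Game
  conjs [] = []
  conjs (g ∷ gs) = conj g ∷ conjs gs

-- Misère outcomes.
-- leftFirstWins G  : o^L(G) = 𝓛   (Left, moving first, wins under misère play)
-- rightFirstWins G : o^R(G) = 𝓡   (Right, moving first, wins under misère play)

mutual
  leftFirstWins : Game → Bool
  leftFirstWins (mk [] _) = true
  leftFirstWins (mk (g ∷ gs) _) = someLeftGood (g ∷ gs)

  someLeftGood : List Game → Bool
  someLeftGood [] = false
  someLeftGood (g ∷ gs) = not (rightFirstWins g) ∨ someLeftGood gs

  rightFirstWins : Game → Bool
  rightFirstWins (mk _ []) = true
  rightFirstWins (mk _ (g ∷ gs)) = someRightGood (g ∷ gs)

  someRightGood : List Game → Bool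
  someRightGood [] = false
  someRightGood (g ∷ gs) = not (leftFirstWins g) ∨ someRightGood gs

data Outcome : Set where
  𝓛 𝓝 𝓟 𝓡 : Outcome

outcomeOf : Bool → Bool → Outcome
outcomeOf true  false = 𝓛
outcomeOf true  true  = 𝓝
outcomeOf false false = 𝓟
outcomeOf false true  = 𝓡

o : Game → Outcome
o G = outcomeOf (leftFirstWins G) (rightFirstWins G)

infix 4 _≤ₒ_ _≥ₒ_

data _≤ₒ_ : Outcome → Outcome → Set where
  𝓡≤ : ∀ {x} → 𝓡 ≤ₒ x
  ≤𝓛 : ∀ {x} → x ≤ₒ 𝓛
  𝓝≤𝓝 : 𝓝 ≤ₒ 𝓝
  𝓟≤𝓟 : 𝓟 ≤ₒ 𝓟

_≥ₒ_ : Outcome → Outcome → Set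
x ≥ₒ y = y ≤ₒ x

data Subposition : Game → Game → Set where
  here   : ∀ {G} → Subposition G G
  viaL   : ∀ {GL GR H K} → H ∈ GL → Subposition H K → Subposition (mk GL GR) K
  viaR   : ∀ {GL GR H K} → H ∈ GR → Subposition H K → Subposition (mk GL GR) K

LeftEnd : Game → Set
LeftEnd G = lefts G ≡ []

RightEnd : Game → Set
RightEnd G = rights G ≡ []

LeftDeadEnd : Game → Set
LeftDeadEnd G = ∀ H → Subposition G H → LeftEnd H

RightDeadEnd : Game → Set
RightDeadEnd G = ∀ H → Subposition G H → RightEnd H

DeadEnding : Game → Set
DeadEnding G = ∀ H → Subposition G H →
  (LeftEnd H → LeftDeadEnd H) × (RightEnd H → RightDeadEnd H)

record IsUniverse (U : Game → Set) : Set where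
  field
    closed-left   : ∀ {G H} → U G → H ∈ lefts G → U H
    closed-right  : ∀ {G H} → U G → H ∈ rights G → U H
    closed-sum    : ∀ {G H} → U G → U H → U (G + H)
    closed-conj   : ∀ {G} → U G → U (conj G)
    closed-form   : ∀ (S T : List Game) → S ≢ [] → T ≢ [] →
                    All U S → All U T → U (mk S T)

DeadEndingUniverse : (Game → Set) → Set
DeadEndingUniverse U = IsUniverse U × (∀ G → U G → DeadEnding G)

LeftStrong : (Game → Set) → Game → Set
LeftStrong U G = ∀ X → U X → LeftEnd X → o (G + X) ≥ₒ 𝓝

mutual
  birthday : Game → ℕ
  birthday (mk GL GR) = maxSucc GL ⊔ maxSucc GR

  maxSucc : List Game → ℕ
  maxSucc [] = 0
  maxSucc (g ∷ gs) = suc (birthday g) ⊔ maxSucc gs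

τ : ℕ → Game → Game
τ zero G = zeroG
τ (suc n) (mk GL GR) = mk (map (τ n) GL) (map (τ n) GR)

infix 4 _≥D_
_≥D_ : Game → Game → Set
G ≥D H = ∀ X → o (G + X) ≥ₒ o (H + X)

data Cl (A : Game → Set) : Game → Set where
  base   : ∀ {G} → A G → Cl A G
  optL   : ∀ {G H} → Cl A G → H ∈ lefts G → Cl A H
  optR   : ∀ {G H} → Cl A G → H ∈ rights G → Cl A H
  sum    : ∀ {G H} → Cl A G → Cl A H → Cl A (G + H)

LeftEndsOf : (Game → Set) → Game → Set
LeftEndsOf U X = U X × LeftEnd X

T : ℕ → (Game → Set) → Game → Set
T n U X =
  (∃ λ G → Cl (LeftEndsOf U) G × X ≡ τ n G) ×
  (∀ G → Cl (LeftEndsOf U) G → X ≥D τ n G → τ n G ≥D X)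

-- Left strength only tests Left ends X of U, which are Left dead-ends, and Left's first-move
-- outcome of G + X never looks deeper into X than birthday G = n, so X may be replaced by its
-- truncation τ n X.  A Left dead-end is determined up to outcome equivalence (o(X + Z) = o(Y + Z)
-- for all Z) by the equivalence classes of its Right options, so the depth-n truncations fall into
-- finitely many classes; hence below every τ n X lies a minimal element, i.e. a member of T n U,
-- and o(G + ·) ≥ 𝓝 passes up along ≥ because + is commutative up to outcome.  Outcome equivalence
-- is undecidable, so the minimal element is found only under double negation, which the decidable
-- goal absorbs.

module Submission where

open import Defs
open import Level using (0ℓ)
open import Function using (_∘_; flip)
open import Function.Bundles using (_⇔_; mk⇔; Equivalence)
open import Function.Properties.Equivalence using () renaming (trans to ⇔-trans; sym to ⇔-sym)
open import Data.Nat using (ℕ; zero; suc; _≤_; _<_; s≤s)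
open import Data.Nat.Properties using (≤-refl; <⇒≤; m⊔n≤o⇒m≤o; m⊔n≤o⇒n≤o)
open import Data.Bool using (Bool; true; false)
open import Data.Bool.Properties using (⇔→≡)
open import Data.List using (List; []; _∷_; _++_; map)
open import Data.List.Relation.Unary.Any using (Any; here; there)
open import Data.List.Relation.Unary.All using (All; []; _∷_; lookup)
open import Data.List.Relation.Unary.All.Properties using (++⁺)
open import Data.List.Membership.Propositional using (_∈_; find; lose)
open import Data.List.Membership.Propositional.Properties
  using (∈-map⁺; ∈-map⁻; ∈-++⁺ˡ; ∈-++⁺ʳ; ∈-++⁻)
open import Data.List.Relation.Binary.Subset.Propositional using (_⊆_)
open import Data.List.Relation.Binary.Subset.Propositional.Properties
  using (xs⊆xs++ys; xs⊆ys++xs)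
open import Data.Product using (_×_; ∃; _,_; proj₁; proj₂)
open import Data.Sum using (_⊎_; inj₁; inj₂; [_,_]′)
import Data.Sum as Sum
open import Relation.Nullary
  using (¬_; Dec; yes; no; contradiction; decidable-stable; ¬¬-excluded-middle)
open import Relation.Nullary.Negation using (¬¬-Monad; ¬¬-map)
open import Relation.Binary.PropositionalEquality
  using (_≡_; refl; sym; trans; cong; cong₂; subst; subst₂)
open import Effect.Monad using (RawMonad)

open Equivalence using (to; from)
open RawMonad (¬¬-Monad {a = 0ℓ}) using (_>>=_; pure)

private variable
  A : Set
  _∼_ _∼′_ : A → A → Set
  x y c : A
  xs ys us vs zs cs : List A

≤ₒ-refl : ∀ {x} → x ≤ₒ x
≤ₒ-refl {𝓛} = ≤𝓛
≤ₒ-refl {𝓝} = 𝓝≤𝓝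
≤ₒ-refl {𝓟} = 𝓟≤𝓟
≤ₒ-refl {𝓡} = 𝓡≤

≤ₒ-trans : ∀ {x y z} → x ≤ₒ y → y ≤ₒ z → x ≤ₒ z
≤ₒ-trans 𝓡≤ _ = 𝓡≤
≤ₒ-trans _ ≤𝓛 = ≤𝓛
≤ₒ-trans 𝓝≤𝓝 𝓝≤𝓝 = 𝓝≤𝓝
≤ₒ-trans 𝓟≤𝓟 𝓟≤𝓟 = 𝓟≤𝓟

infix 4 _≤ₒ?_
_≤ₒ?_ : ∀ x y → Dec (x ≤ₒ y)
𝓡 ≤ₒ? _ = yes 𝓡≤
_ ≤ₒ? 𝓛 = yes ≤𝓛
𝓝 ≤ₒ? 𝓝 = yes 𝓝≤𝓝
𝓟 ≤ₒ? 𝓟 = yes 𝓟≤𝓟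
𝓛 ≤ₒ? 𝓝 = no λ ()
𝓛 ≤ₒ? 𝓟 = no λ ()
𝓛 ≤ₒ? 𝓡 = no λ ()
𝓝 ≤ₒ? 𝓟 = no λ ()
𝓝 ≤ₒ? 𝓡 = no λ ()
𝓟 ≤ₒ? 𝓝 = no λ ()
𝓟 ≤ₒ? 𝓡 = no λ ()

outcomeOf-≥𝓝 : ∀ a b → outcomeOf a b ≥ₒ 𝓝 ⇔ a ≡ true
outcomeOf-≥𝓝 true false = mk⇔ (λ _ → refl) (λ _ → ≤𝓛)
outcomeOf-≥𝓝 true true = mk⇔ (λ _ → refl) (λ _ → 𝓝≤𝓝)
outcomeOf-≥𝓝 false false = mk⇔ (λ ()) (λ ())
outcomeOf-≥𝓝 false true = mk⇔ (λ ()) (λ ())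

≥𝓝-cong : ∀ G H → leftFirstWins G ≡ leftFirstWins H → o G ≥ₒ 𝓝 ⇔ o H ≥ₒ 𝓝
≥𝓝-cong G H e =
  ⇔-trans (outcomeOf-≥𝓝 _ _)
    (subst (λ a → a ≡ true ⇔ o H ≥ₒ 𝓝) (sym e) (⇔-sym (outcomeOf-≥𝓝 _ _)))

o⇒leftFirstWins : ∀ G H → o G ≡ o H → leftFirstWins G ≡ leftFirstWins H
o⇒leftFirstWins G H e =
  ⇔→≡ (⇔-trans (⇔-sym (outcomeOf-≥𝓝 _ _))
        (subst (λ x → x ≥ₒ 𝓝 ⇔ leftFirstWins H ≡ true) (sym e) (outcomeOf-≥𝓝 _ _)))

Covers : (A → A → Set) → List A → List A → Set
Covers _∼_ xs ys = ∀ {x} → x ∈ xs → ∃ λ y → y ∈ ys × x ∼ y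

Match : (A → A → Set) → List A → List A → Set
Match _∼_ xs ys = Covers _∼_ xs ys × Covers (flip _∼_) ys xs

Covers-++ : Covers _∼_ xs zs → Covers _∼_ ys zs → Covers _∼_ (xs ++ ys) zs
Covers-++ {xs = xs} c d x∈ = [ c , d ]′ (∈-++⁻ xs x∈)

Covers-⊆ : Covers _∼_ xs ys → ys ⊆ zs → Covers _∼_ xs zs
Covers-⊆ c ys⊆zs x∈ = let y , y∈ , x∼y = c x∈ in y , ys⊆zs y∈ , x∼y

Covers-Any : ∀ {P : A → Set} → (∀ {x y} → x ∼ y → P x → P y) →
             Covers _∼_ xs ys → Any P xs → Any P ys
Covers-Any resp c px with find px
... | x , x∈ , Px with c x∈
...   | y , y∈ , x∼y = lose y∈ (resp x∼y Px)

Covers-[] : Covers _∼_ xs ys → ys ≡ [] → xs ≡ []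
Covers-[] {xs = []} _ _ = refl
Covers-[] {xs = x ∷ xs} c refl with c (here refl)
... | _ , () , _

Match-[] : Match _∼_ [] []
Match-[] = (λ ()) , (λ ())

Covers-∷ : x ∼ y → Covers _∼_ xs ys → Covers _∼_ (x ∷ xs) (y ∷ ys)
Covers-∷ x∼y c (here refl) = _ , here refl , x∼y
Covers-∷ x∼y c (there x∈) = let z , z∈ , x∼z = c x∈ in z , there z∈ , x∼z

Match-∷ : x ∼ y → Match _∼_ xs ys → Match _∼_ (x ∷ xs) (y ∷ ys)
Match-∷ x∼y (c , d) = Covers-∷ x∼y c , Covers-∷ x∼y d

Match-++ : Match _∼_ xs ys → Match _∼_ us vs → Match _∼_ (xs ++ us) (ys ++ vs)
Match-++ {xs = xs} {ys} {us} {vs} (c , c′) (d , d′) =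
  Covers-++ (Covers-⊆ c (xs⊆xs++ys ys vs)) (Covers-⊆ d (xs⊆ys++xs vs ys)) ,
  Covers-++ (Covers-⊆ c′ (xs⊆xs++ys xs us)) (Covers-⊆ d′ (xs⊆ys++xs us xs))

Match-++-swap : Match _∼_ xs vs → Match _∼_ us ys → Match _∼_ (xs ++ us) (ys ++ vs)
Match-++-swap {xs = xs} {vs} {us} {ys} (c , c′) (d , d′) =
  Covers-++ (Covers-⊆ c (xs⊆ys++xs vs ys)) (Covers-⊆ d (xs⊆xs++ys ys vs)) ,
  Covers-++ (Covers-⊆ d′ (xs⊆ys++xs us xs)) (Covers-⊆ c′ (xs⊆xs++ys xs us))

Covers-map : (f : A → A) → (∀ {x y} → x ∼ y → f x ∼′ f y) →
             Covers _∼_ xs ys → Covers _∼′_ (map f xs) (map f ys)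
Covers-map f resp c fx∈ with ∈-map⁻ f fx∈
... | x , x∈ , refl = let y , y∈ , x∼y = c x∈ in f y , ∈-map⁺ f y∈ , resp x∼y

Match-map : (f : A → A) → (∀ {x y} → x ∼ y → f x ∼′ f y) →
            Match _∼_ xs ys → Match _∼′_ (map f xs) (map f ys)
Match-map f resp (c , d) = Covers-map f resp c , Covers-map f resp d

sublists : List A → List (List A)
sublists [] = [] ∷ []
sublists (x ∷ xs) = map (x ∷_) (sublists xs) ++ sublists xs

¬¬-filter : (Q : A → Set) → ∀ xs →
            ¬ ¬ (∃ λ ys → ys ∈ sublists xs × (∀ {y} → y ∈ ys → Q y)
                                           × (∀ {x} → x ∈ xs → Q x → x ∈ ys))
¬¬-filter Q [] = pure ([] , here refl , (λ ()) , λ ())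
¬¬-filter Q (x ∷ xs) = do
  ys , ys∈ , sound , complete ← ¬¬-filter Q xs
  yes Qx ← ¬¬-excluded-middle
    where no ¬Qx → pure (ys , ∈-++⁺ʳ _ ys∈ , (λ {y} y∈ → sound y∈) ,
                        λ { (here refl) Qx → contradiction Qx ¬Qx ; (there x∈) → complete x∈ })
  pure (x ∷ ys , ∈-++⁺ˡ (∈-map⁺ (x ∷_) ys∈) ,
        (λ { (here refl) → Qx ; (there y∈) → sound y∈ }) ,
        λ { (here refl) _ → here refl ; (there x∈) Qx′ → there (complete x∈ Qx′) })

¬¬-Match-sublist : ∀ {xs} ys → Covers _∼_ xs ys → ¬ ¬ (∃ λ zs → zs ∈ sublists ys × Match _∼_ xs zs)
¬¬-Match-sublist {_∼_ = _∼_} {xs = xs} ys cover = do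
  zs , zs∈ , sound , complete ← ¬¬-filter (λ z → ∃ λ x → x ∈ xs × x ∼ z) ys
  pure (zs , zs∈ ,
        (λ {x} x∈ → let y , y∈ , x∼y = cover x∈ in y , complete y∈ (_ , x∈ , x∼y) , x∼y) ,
        λ {z} z∈ → sound z∈)

module _ {A I : Set} (_≽_ : A → A → Set)
         (≽-refl : ∀ {x} → x ≽ x) (≽-trans : ∀ {x y z} → x ≽ y → y ≽ z → x ≽ z)
         (≽-stable : ∀ {x y} → ¬ ¬ (x ≽ y) → x ≽ y)
         (P : I → Set) (f : I → A) where

  Minimal : A → Set
  Minimal x = (∃ λ i → P i × x ≡ f i) × (∀ i → P i → x ≽ f i → f i ≽ x)

  CoveredBy : List A → A → Set
  CoveredBy cs x = ∃ λ c → c ∈ cs × x ≽ c × c ≽ x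

  ¬¬-CoveredBy-tail : ¬ (x ≽ c × c ≽ x) → ¬ ¬ CoveredBy (c ∷ cs) x → ¬ ¬ CoveredBy cs x
  ¬¬-CoveredBy-tail x≉c = ¬¬-map λ where
    (_ , here refl , x≈c) → contradiction x≈c x≉c
    (c′ , there c′∈ , x≈c′) → c′ , c′∈ , x≈c′

  -- Descent along cs: either the current witness j is minimal, or we step strictly below it,
  -- after which the head c (equivalent to j) can cover nothing further down.
  ¬¬-minimal-below : ∀ cs {i} → P i → (∀ j → P j → f i ≽ f j → ¬ ¬ CoveredBy cs (f j)) →
                     ¬ ¬ (∃ λ x → Minimal x × f i ≽ x)
  ¬¬-minimal-below [] {i} Pi cover = λ _ → cover i Pi ≽-refl λ { (_ , () , _) }
  ¬¬-minimal-below (c ∷ cs) {i} Pi cover = do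
    yes (j , Pj , i≽j , j≽c , c≽j)
      ← ¬¬-excluded-middle {A = ∃ λ j → P j × f i ≽ f j × f j ≽ c × c ≽ f j}
      where no miss → ¬¬-minimal-below cs Pi λ k Pk i≽k →
                        ¬¬-CoveredBy-tail (λ k≈c → miss (k , Pk , i≽k , k≈c)) (cover k Pk i≽k)
    yes (k , Pk , j≽k , k⋡j)
      ← ¬¬-excluded-middle {A = ∃ λ k → P k × f j ≽ f k × ¬ f k ≽ f j}
      where no none-below →
              pure (f j , ((j , Pj , refl) ,
                           λ k Pk j≽k → ≽-stable λ k⋡j → none-below (k , Pk , j≽k , k⋡j)) ,
                    i≽j)
    x , minimal , k≽x ← ¬¬-minimal-below cs Pk λ l Pl k≽l →
      ¬¬-CoveredBy-tail (λ (l≽c , _) → k⋡j (≽-trans k≽l (≽-trans l≽c c≽j)))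
                        (cover l Pl (≽-trans i≽j (≽-trans j≽k k≽l)))
    pure (x , minimal , ≽-trans i≽j (≽-trans j≽k k≽x))

private variable
  G H X : Game
  GL GR GL′ GR′ R S : List Game

someLeftGood⇔Any : ∀ gs → someLeftGood gs ≡ true ⇔ Any (λ g → rightFirstWins g ≡ false) gs
someLeftGood⇔Any [] = mk⇔ (λ ()) (λ ())
someLeftGood⇔Any (g ∷ gs) with rightFirstWins g in eq
... | false = mk⇔ (λ _ → here eq) (λ _ → refl)
... | true = mk⇔ (there ∘ to (someLeftGood⇔Any gs))
                 λ { (here e) → contradiction (trans (sym eq) e) λ ()
                   ; (there a) → from (someLeftGood⇔Any gs) a }

someRightGood⇔Any : ∀ gs → someRightGood gs ≡ true ⇔ Any (λ g → leftFirstWins g ≡ false) gs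
someRightGood⇔Any [] = mk⇔ (λ ()) (λ ())
someRightGood⇔Any (g ∷ gs) with leftFirstWins g in eq
... | false = mk⇔ (λ _ → here eq) (λ _ → refl)
... | true = mk⇔ (there ∘ to (someRightGood⇔Any gs))
                 λ { (here e) → contradiction (trans (sym eq) e) λ ()
                   ; (there a) → from (someRightGood⇔Any gs) a }

leftFirstWins⇔ : ∀ GL GR → leftFirstWins (mk GL GR) ≡ true ⇔
                 (GL ≡ [] ⊎ Any (λ g → rightFirstWins g ≡ false) GL)
leftFirstWins⇔ [] GR = mk⇔ (λ _ → inj₁ refl) (λ _ → refl)
leftFirstWins⇔ (g ∷ gs) GR =
  mk⇔ (inj₂ ∘ to (someLeftGood⇔Any (g ∷ gs))) [ (λ ()) , from (someLeftGood⇔Any (g ∷ gs)) ]′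

rightFirstWins⇔ : ∀ GL GR → rightFirstWins (mk GL GR) ≡ true ⇔
                  (GR ≡ [] ⊎ Any (λ g → leftFirstWins g ≡ false) GR)
rightFirstWins⇔ GL [] = mk⇔ (λ _ → inj₁ refl) (λ _ → refl)
rightFirstWins⇔ GL (g ∷ gs) =
  mk⇔ (inj₂ ∘ to (someRightGood⇔Any (g ∷ gs))) [ (λ ()) , from (someRightGood⇔Any (g ∷ gs)) ]′

infix 4 _∼[_]_
_∼[_]_ : List Game → (Game → Bool) → List Game → Set
xs ∼[ w ] ys = Match (λ x y → w x ≡ w y) xs ys

∼-sym : ∀ {w} → xs ∼[ w ] ys → ys ∼[ w ] xs
∼-sym (c , d) = (λ y∈ → let x , x∈ , e = d y∈ in x , x∈ , sym e) ,
                (λ x∈ → let y , y∈ , e = c x∈ in y , y∈ , sym e)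

∼-transfer : ∀ {w b} → xs ∼[ w ] ys →
             xs ≡ [] ⊎ Any (λ x → w x ≡ b) xs → ys ≡ [] ⊎ Any (λ y → w y ≡ b) ys
∼-transfer (c , d) = Sum.map (Covers-[] d) (Covers-Any (λ e p → trans (sym e) p) c)

leftFirstWins-cong : GL ∼[ rightFirstWins ] GL′ →
                     leftFirstWins (mk GL GR) ≡ leftFirstWins (mk GL′ GR′)
leftFirstWins-cong {GL} {GL′} {GR} {GR′} m =
  ⇔→≡ (mk⇔ (from (leftFirstWins⇔ GL′ GR′) ∘ ∼-transfer m ∘ to (leftFirstWins⇔ GL GR))
           (from (leftFirstWins⇔ GL GR) ∘ ∼-transfer (∼-sym m) ∘ to (leftFirstWins⇔ GL′ GR′)))

rightFirstWins-cong : GR ∼[ leftFirstWins ] GR′ →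
                      rightFirstWins (mk GL GR) ≡ rightFirstWins (mk GL′ GR′)
rightFirstWins-cong {GR} {GR′} {GL} {GL′} m =
  ⇔→≡ (mk⇔ (from (rightFirstWins⇔ GL′ GR′) ∘ ∼-transfer m ∘ to (rightFirstWins⇔ GL GR))
           (from (rightFirstWins⇔ GL GR) ∘ ∼-transfer (∼-sym m) ∘ to (rightFirstWins⇔ GL′ GR′)))

mutual
  leftFirstWins-+-comm : ∀ G H → leftFirstWins (G + H) ≡ leftFirstWins (H + G)
  leftFirstWins-+-comm G@(mk GL _) H@(mk HL _) =
    leftFirstWins-cong (Match-++-swap (sumL-comm-rightFirstWins GL H)
                                      (∼-sym (sumL-comm-rightFirstWins HL G)))

  rightFirstWins-+-comm : ∀ G H → rightFirstWins (G + H) ≡ rightFirstWins (H + G)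
  rightFirstWins-+-comm G@(mk _ GR) H@(mk _ HR) =
    rightFirstWins-cong (Match-++-swap (sumL-comm-leftFirstWins GR H)
                                       (∼-sym (sumL-comm-leftFirstWins HR G)))

  sumL-comm-rightFirstWins : ∀ gs H → sumL gs H ∼[ rightFirstWins ] sumR H gs
  sumL-comm-rightFirstWins [] H = Match-[]
  sumL-comm-rightFirstWins (g ∷ gs) H =
    Match-∷ (rightFirstWins-+-comm g H) (sumL-comm-rightFirstWins gs H)

  sumL-comm-leftFirstWins : ∀ gs H → sumL gs H ∼[ leftFirstWins ] sumR H gs
  sumL-comm-leftFirstWins [] H = Match-[]
  sumL-comm-leftFirstWins (g ∷ gs) H =
    Match-∷ (leftFirstWins-+-comm g H) (sumL-comm-leftFirstWins gs H)

o-+-comm : ∀ G H → o (G + H) ≡ o (H + G)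
o-+-comm G H = cong₂ outcomeOf (leftFirstWins-+-comm G H) (rightFirstWins-+-comm G H)

data LeftDeadEndᵢ : Game → Set where
  deadEnd : All LeftDeadEndᵢ GR → LeftDeadEndᵢ (mk [] GR)

LeftDeadEndᵢ⇒LeftEnd : LeftDeadEndᵢ G → LeftEnd G
LeftDeadEndᵢ⇒LeftEnd (deadEnd _) = refl

mutual
  LeftDeadEnd⇒LeftDeadEndᵢ : ∀ G → LeftDeadEnd G → LeftDeadEndᵢ G
  LeftDeadEnd⇒LeftDeadEndᵢ (mk GL GR) dead with dead _ here
  ... | refl = deadEnd (LeftDeadEnd⇒LeftDeadEndᵢ-All GR λ g∈ K sub → dead K (viaR g∈ sub))

  LeftDeadEnd⇒LeftDeadEndᵢ-All : ∀ gs → (∀ {g} → g ∈ gs → LeftDeadEnd g) → All LeftDeadEndᵢ gs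
  LeftDeadEnd⇒LeftDeadEndᵢ-All [] _ = []
  LeftDeadEnd⇒LeftDeadEndᵢ-All (g ∷ gs) dead =
    LeftDeadEnd⇒LeftDeadEndᵢ g (dead (here refl)) ∷ LeftDeadEnd⇒LeftDeadEndᵢ-All gs (dead ∘ there)

mutual
  +-LeftDeadEndᵢ : LeftDeadEndᵢ G → LeftDeadEndᵢ H → LeftDeadEndᵢ (G + H)
  +-LeftDeadEndᵢ dG@(deadEnd dGR) dH@(deadEnd dHR) =
    deadEnd (++⁺ (sumL-LeftDeadEndᵢ dGR dH) (sumR-LeftDeadEndᵢ dG dHR))

  sumL-LeftDeadEndᵢ : All LeftDeadEndᵢ R → LeftDeadEndᵢ H → All LeftDeadEndᵢ (sumL R H)
  sumL-LeftDeadEndᵢ [] _ = []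
  sumL-LeftDeadEndᵢ (d ∷ ds) dH = +-LeftDeadEndᵢ d dH ∷ sumL-LeftDeadEndᵢ ds dH

  sumR-LeftDeadEndᵢ : LeftDeadEndᵢ G → All LeftDeadEndᵢ R → All LeftDeadEndᵢ (sumR G R)
  sumR-LeftDeadEndᵢ _ [] = []
  sumR-LeftDeadEndᵢ dG (d ∷ ds) = +-LeftDeadEndᵢ dG d ∷ sumR-LeftDeadEndᵢ dG ds

module _ {U : Game → Set} (dead-ending : DeadEndingUniverse U) where
  open IsUniverse (proj₁ dead-ending)

  LeftEnd⇒LeftDeadEndᵢ : U G → LeftEnd G → LeftDeadEndᵢ G
  LeftEnd⇒LeftDeadEndᵢ {G} uG end =
    LeftDeadEnd⇒LeftDeadEndᵢ G (proj₁ (proj₂ dead-ending G uG G here) end)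

  Cl-LeftEndsOf-sound : Cl (LeftEndsOf U) G → U G × LeftDeadEndᵢ G
  Cl-LeftEndsOf-sound (base (uG , end)) = uG , LeftEnd⇒LeftDeadEndᵢ uG end
  Cl-LeftEndsOf-sound (optL H∈cl g∈) with Cl-LeftEndsOf-sound H∈cl
  ... | _ , deadEnd _ = contradiction g∈ λ ()
  Cl-LeftEndsOf-sound (optR H∈cl g∈) with Cl-LeftEndsOf-sound H∈cl
  ... | uH , deadEnd dR = closed-right uH g∈ , lookup dR g∈
  Cl-LeftEndsOf-sound (sum G∈cl H∈cl) =
    let uG , dG = Cl-LeftEndsOf-sound G∈cl
        uH , dH = Cl-LeftEndsOf-sound H∈cl
    in closed-sum uG uH , +-LeftDeadEndᵢ dG dH

birthday-lefts : ∀ {m} GL GR → birthday (mk GL GR) ≤ m → maxSucc GL ≤ m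
birthday-lefts GL GR = m⊔n≤o⇒m≤o (maxSucc GL) (maxSucc GR)

birthday-rights : ∀ {m} GL GR → birthday (mk GL GR) ≤ m → maxSucc GR ≤ m
birthday-rights GL GR = m⊔n≤o⇒n≤o (maxSucc GL) (maxSucc GR)

maxSucc-head : ∀ {m} g gs → maxSucc (g ∷ gs) ≤ m → birthday g < m
maxSucc-head g gs = m⊔n≤o⇒m≤o (suc (birthday g)) (maxSucc gs)

maxSucc-tail : ∀ {m} g gs → maxSucc (g ∷ gs) ≤ m → maxSucc gs ≤ m
maxSucc-tail g gs = m⊔n≤o⇒n≤o (suc (birthday g)) (maxSucc gs)

-- Left has no move in a Left dead-end H, so only Right's moves in H use up the depth of
-- the truncation; this is why the bound on G must be strict for Right but not for Left.
mutual
  leftFirstWins-τ : ∀ m G → LeftDeadEndᵢ H → birthday G ≤ m →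
                    leftFirstWins (G + H) ≡ leftFirstWins (G + τ m H)
  leftFirstWins-τ zero (mk [] GR) (deadEnd _) _ = refl
  leftFirstWins-τ zero (mk (g ∷ GL) GR) _ b with maxSucc-head g GL (birthday-lefts (g ∷ GL) GR b)
  ... | ()
  leftFirstWins-τ (suc k) (mk GL GR) dH@(deadEnd _) b =
    leftFirstWins-cong
      (Match-++ (sumL-τ-rightFirstWins (suc k) GL dH (birthday-lefts GL GR b)) Match-[])

  rightFirstWins-τ : ∀ m G → LeftDeadEndᵢ H → birthday G < m →
                     rightFirstWins (G + H) ≡ rightFirstWins (G + τ m H)
  rightFirstWins-τ (suc k) G@(mk GL GR) dH@(deadEnd dR) (s≤s b) =
    rightFirstWins-cong
      (Match-++ (sumL-τ-leftFirstWins (suc k) GR dH (<⇒≤ (s≤s (birthday-rights GL GR b))))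
                (sumR-τ-leftFirstWins k G dR b))

  sumL-τ-rightFirstWins : ∀ m gs → LeftDeadEndᵢ H → maxSucc gs ≤ m →
                          sumL gs H ∼[ rightFirstWins ] sumL gs (τ m H)
  sumL-τ-rightFirstWins m [] _ _ = Match-[]
  sumL-τ-rightFirstWins m (g ∷ gs) dH b =
    Match-∷ (rightFirstWins-τ m g dH (maxSucc-head g gs b))
            (sumL-τ-rightFirstWins m gs dH (maxSucc-tail g gs b))

  sumL-τ-leftFirstWins : ∀ m gs → LeftDeadEndᵢ H → maxSucc gs ≤ m →
                         sumL gs H ∼[ leftFirstWins ] sumL gs (τ m H)
  sumL-τ-leftFirstWins m [] _ _ = Match-[]
  sumL-τ-leftFirstWins m (g ∷ gs) dH b =
    Match-∷ (leftFirstWins-τ m g dH (<⇒≤ (maxSucc-head g gs b)))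
            (sumL-τ-leftFirstWins m gs dH (maxSucc-tail g gs b))

  sumR-τ-leftFirstWins : ∀ k G → All LeftDeadEndᵢ R → birthday G ≤ k →
                         sumR G R ∼[ leftFirstWins ] sumR G (map (τ k) R)
  sumR-τ-leftFirstWins k G [] _ = Match-[]
  sumR-τ-leftFirstWins k G (d ∷ ds) b =
    Match-∷ (leftFirstWins-τ k G d b) (sumR-τ-leftFirstWins k G ds b)

≥𝓝-τ : ∀ m G → LeftDeadEndᵢ H → birthday G ≤ m → o (G + H) ≥ₒ 𝓝 ⇔ o (G + τ m H) ≥ₒ 𝓝
≥𝓝-τ {H} m G dH b = ≥𝓝-cong (G + H) (G + τ m H) (leftFirstWins-τ m G dH b)

infix 4 _≈_
record _≈_ (G H : Game) : Set where
  constructor ≈-intro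
  field ≈-outcome : ∀ X → o (G + X) ≡ o (H + X)
open _≈_

≈-sym : G ≈ H → H ≈ G
≈-sym e = ≈-intro λ X → sym (≈-outcome e X)

≈⇒≥D : G ≈ H → G ≥D H
≈⇒≥D {G} e X = subst (_≤ₒ o (G + X)) (≈-outcome e X) ≤ₒ-refl

≥D-refl : G ≥D G
≥D-refl X = ≤ₒ-refl

≥D-trans : G ≥D H → H ≥D X → G ≥D X
≥D-trans G≥H H≥X Y = ≤ₒ-trans (H≥X Y) (G≥H Y)

≥D-stable : ¬ ¬ (G ≥D H) → G ≥D H
≥D-stable {G} {H} ¬¬G≥H X =
  decidable-stable (o (H + X) ≤ₒ? o (G + X)) (¬¬-map (λ G≥H → G≥H X) ¬¬G≥H)

≥𝓝-mono-≥D : ∀ G H X → G ≥D H → o (X + H) ≥ₒ 𝓝 → o (X + G) ≥ₒ 𝓝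
≥𝓝-mono-≥D G H X G≥H X+H≥𝓝 =
  subst (_≥ₒ 𝓝) (o-+-comm G X) (≤ₒ-trans (subst (_≥ₒ 𝓝) (o-+-comm X H) X+H≥𝓝) (G≥H X))

sumL≡map : ∀ gs H → sumL gs H ≡ map (_+ H) gs
sumL≡map [] H = refl
sumL≡map (g ∷ gs) H = cong (g + H ∷_) (sumL≡map gs H)

sumL-≈ : ∀ X → Match _≈_ R S → sumL R X ∼[ leftFirstWins ] sumL S X
sumL-≈ {R} {S} X m =
  subst₂ (_∼[ leftFirstWins ]_) (sym (sumL≡map R X)) (sym (sumL≡map S X))
         (Match-map (_+ X) (λ {x} {y} e → o⇒leftFirstWins (x + X) (y + X) (≈-outcome e X)) m)

mutual
  leftFirstWins-mk[]-≈ : Match _≈_ R S → ∀ X →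
                         leftFirstWins (mk [] R + X) ≡ leftFirstWins (mk [] S + X)
  leftFirstWins-mk[]-≈ m (mk XL _) = leftFirstWins-cong (sumR-mk[]-≈-rightFirstWins m XL)

  rightFirstWins-mk[]-≈ : Match _≈_ R S → ∀ X →
                          rightFirstWins (mk [] R + X) ≡ rightFirstWins (mk [] S + X)
  rightFirstWins-mk[]-≈ m X@(mk _ XR) =
    rightFirstWins-cong (Match-++ (sumL-≈ X m) (sumR-mk[]-≈-leftFirstWins m XR))

  sumR-mk[]-≈-rightFirstWins : Match _≈_ R S → ∀ xs →
                               sumR (mk [] R) xs ∼[ rightFirstWins ] sumR (mk [] S) xs
  sumR-mk[]-≈-rightFirstWins m [] = Match-[]
  sumR-mk[]-≈-rightFirstWins m (x ∷ xs) =
    Match-∷ (rightFirstWins-mk[]-≈ m x) (sumR-mk[]-≈-rightFirstWins m xs)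

  sumR-mk[]-≈-leftFirstWins : Match _≈_ R S → ∀ xs →
                              sumR (mk [] R) xs ∼[ leftFirstWins ] sumR (mk [] S) xs
  sumR-mk[]-≈-leftFirstWins m [] = Match-[]
  sumR-mk[]-≈-leftFirstWins m (x ∷ xs) =
    Match-∷ (leftFirstWins-mk[]-≈ m x) (sumR-mk[]-≈-leftFirstWins m xs)

mk[]-≈ : Match _≈_ R S → mk [] R ≈ mk [] S
mk[]-≈ m = ≈-intro λ X → cong₂ outcomeOf (leftFirstWins-mk[]-≈ m X) (rightFirstWins-mk[]-≈ m X)

representatives : ℕ → List Game
representatives zero = zeroG ∷ []
representatives (suc n) = map (mk []) (sublists (representatives n))

mutual
  ¬¬-represented : ∀ n → LeftDeadEndᵢ H → ¬ ¬ (∃ λ c → c ∈ representatives n × τ n H ≈ c)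
  ¬¬-represented zero _ = pure (zeroG , here refl , ≈-intro λ _ → refl)
  ¬¬-represented (suc n) (deadEnd dR) = do
    cover ← ¬¬-Covers-representatives n dR
    S , S∈ , m ← ¬¬-Match-sublist (representatives n) cover
    pure (mk [] S , ∈-map⁺ (mk []) S∈ , mk[]-≈ m)

  ¬¬-Covers-representatives : ∀ n → All LeftDeadEndᵢ R →
                              ¬ ¬ Covers _≈_ (map (τ n) R) (representatives n)
  ¬¬-Covers-representatives n [] = pure λ ()
  ¬¬-Covers-representatives n (d ∷ ds) = do
    c , c∈ , e ← ¬¬-represented n d
    cover ← ¬¬-Covers-representatives n ds
    pure λ { (here refl) → c , c∈ , e ; (there r∈) → cover r∈ }

-- T n U X is by definition Minimal _≥D_ … (Cl (LeftEndsOf U)) (τ n) X.  The order laws are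
-- eta-expanded because _≥D_ unfolds to a Π-type from which the games cannot be inferred.
¬¬-T-below : ∀ {U} → DeadEndingUniverse U → ∀ n → Cl (LeftEndsOf U) H →
             ¬ ¬ (∃ λ X → T n U X × τ n H ≥D X)
¬¬-T-below dead-ending n H∈cl =
  ¬¬-minimal-below _≥D_ (λ {G} → ≥D-refl {G}) (λ {G} {H} {X} → ≥D-trans {G} {H} {X})
                   (λ {G} {H} → ≥D-stable {G} {H}) _ (τ n) (representatives n) H∈cl
                   λ K K∈cl _ → do
    c , c∈ , e ← ¬¬-represented n (proj₂ (Cl-LeftEndsOf-sound dead-ending K∈cl))
    pure (c , c∈ , ≈⇒≥D e , ≈⇒≥D (≈-sym e))

theorem4p10 : (U : Game → Set) → DeadEndingUniverse U → (G : Game) →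
    LeftStrong U G ⇔ (∀ X → T (birthday G) U X → o (G + X) ≥ₒ 𝓝)
theorem4p10 U dead-ending G = mk⇔ strong⇒T T⇒strong
  where
  n = birthday G

  strong⇒T : LeftStrong U G → ∀ X → T n U X → o (G + X) ≥ₒ 𝓝
  strong⇒T strong _ ((H , H∈cl , refl) , _) =
    let uH , dH = Cl-LeftEndsOf-sound dead-ending H∈cl
    in to (≥𝓝-τ n G dH ≤-refl) (strong H uH (LeftDeadEndᵢ⇒LeftEnd dH))

  T⇒strong : (∀ X → T n U X → o (G + X) ≥ₒ 𝓝) → LeftStrong U G
  T⇒strong T⇒≥𝓝 Y uY end =
    from (≥𝓝-τ n G (LeftEnd⇒LeftDeadEndᵢ dead-ending uY end) ≤-refl)
      (decidable-stable (𝓝 ≤ₒ? o (G + τ n Y)) do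
        X , X∈T , τY≥X ← ¬¬-T-below dead-ending n (base (uY , end))
        pure (≥𝓝-mono-≥D (τ n Y) X G τY≥X (T⇒≥𝓝 X X∈T)))
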